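{- Let $p_\phi$ be a program that is safe with respect to a variable typing environment $\Gamma$ and a safe operator typing environment $\Delta$. For every expression $e$ occurring in $p_\phi$ and all tiers $t,t_{in},t_{out}$, if $\Gamma,\Delta\vdash e:(t,t_{in},t_{out})$, then $t\preceq\Gamma(x)$ for every variable $x$ occurring in $e$.
   Context: Programs. Fix a set of variables and a set of operators, each operator $\mathtt{op}$ having an arity $ar(\mathtt{op})\ge0$ and a total function $[\![\mathtt{op}]\!]$ on words. With a single oracle symbol $\phi$: expressions $e::=x\mid \mathtt{op}(e_1,\dots,e_{ar(\mathtt{op})})\mid \phi(e_1\upharpoonright e_2)$; commands $c::=\mathtt{skip}\mid x:=e\mid c_1;c_2\mid \mathtt{if}(e)\{c_1\}\,\mathtt{else}\,\{c_0\}\mid \mathtt{while}(e)\{c\}$; programs $p_\phi::=c\ \mathtt{return}\ x$. Operators. For words, $v\unlhd w$ means $v$ is a contiguous subword of $w$. $\mathtt{op}$ is neutral if $ar(\mathtt{op})=0$, or $[\![\mathtt{op}]\!]$ takes values in $\{0,1\}$, or for all $\bar w$ there is $i$ with $[\![\mathtt{op}]\!](\bar w)\unlhd w_i$. $\mathtt{op}$ is positive if there is a constant $c$ with $|[\![\mathtt{op}]\!](\bar w)|\le\max_i|w_i|+c$ for all $\bar w$. Typing. Tiers are natural numbers $\mathbf 0,\mathbf 1,\dots$ with the usual order $\preceq$ (strict: $\prec$), $\vee=\max$, $\wedge=\min$. A variable typing environment $\Gamma$ maps variables to tiers; an operator typing environment $\Delta$ assigns to each operator $\mathtt{op}$ and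 tier $t$ a set $\Delta(\mathtt{op})(t)$ of types $t_1\to\dots\to t_{ar(\mathtt{op})}\to t'$. Judgments $\Gamma,\Delta\vdash b:(t,t_{in},t_{out})$ are derived by the rules (writing $\vdash$ for $\Gamma,\Delta\vdash$, all tiers arbitrary): (V) $\vdash x:(\Gamma(x),t_{in},t_{out})$; (OP) if $t_1\to\dots\to t_n\to t\in\Delta(\mathtt{op})(t_{in})$ and $\vdash e_i:(t_i,t_{in},t_{out})$ for all $i\le n=ar(\mathtt{op})$ then $\vdash\mathtt{op}(e_1,\dots,e_n):(t,t_{in},t_{out})$; (OR) if $\vdash e_1:(t,t_{in},t_{out})$, $\vdash e_2:(t_{out},t_{in},t_{out})$, $t\prec t_{in}$ and $t\preceq t_{out}$ then $\vdash\phi(e_1\upharpoonright e_2):(t,t_{in},t_{out})$; (SUB) for a command $c$, if $\vdash c:(t,t_{in},t_{out})$ then $\vdash c:(t+1,t_{in},t_{out})$; (SK) $\vdash\mathtt{skip}:(\mathbf0,t_{in},t_{out})$; (A) if $\vdash x:(t_1,t_{in},t_{out})$, $\vdash e:(t_2,t_{in},t_{out})$, $t_1\preceq t_2$ then $\vdash x:=e:(t_1,t_{in},t_{out})$; (S) if $\vdash c_1:\tau$ and $\vdash c_2:\tau$ then $\vdash c_1;c_2:\tau$; (C) if $\vdash e:\tau$, $\vdash c_1:\tau$, $\vdash c_0:\tau$ then $\vdash\mathtt{if}(e)\{c_1\}\mathtt{else}\{c_0\}:\tau$; (W) if $\vdash e:(t,t_{in},t_{out})$, $\vdash c:(t,t,t_{out})$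 and $\mathbf1\preceq t\preceq t_{out}$ then $\vdash\mathtt{while}(e)\{c\}:(t,t_{in},t_{out})$; (W$_0$) if $\vdash e:(t,t_{in},t)$, $\vdash c:(t,t,t)$ and $\mathbf1\preceq t$ then $\vdash\mathtt{while}(e)\{c\}:(t,t_{in},\mathbf0)$. Safety. $\Delta$ is safe if for each operator $\mathtt{op}$ it types with $ar(\mathtt{op})>0$: $\mathtt{op}$ is neutral or positive, $[\![\mathtt{op}]\!]$ is polynomial-time computable, and for every tier $t_{in}$ and every $t_1\to\dots\to t_n\to t\in\Delta(\mathtt{op})(t_{in})$: $t\preceq\wedge_i t_i\preceq\vee_i t_i\preceq t_{in}$, and $t\prec t_{in}$ if $\mathtt{op}$ is positive but not neutral. A program $c\ \mathtt{return}\ x$ is safe with respect to $\Gamma,\Delta$ if $\Delta$ is safe and $\Gamma,\Delta\vdash c:(t,t_{in},t_{out})$ for some tiers. -}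

module Defs where

open import Data.Nat using (ℕ; zero; suc; _+_; _≤_; _<_; _⊔_)
open import Data.Bool using (Bool; true; false)
open import Data.List using (List; []; _∷_; _++_; length)
open import Data.Vec using (Vec; lookup; foldr′; map)
open import Data.Fin using (Fin)
open import Data.Product using (Σ; ∃; _×_; _,_)
open import Data.Sum using (_⊎_)
open import Relation.Binary.PropositionalEquality using (_≡_)
open import Relation.Nullary using (¬_)

Word : Set
Word = List Bool

w0 w1 : Word
w0 = false ∷ []
w1 = true ∷ []

_⊴_ : Word → Word → Set
v ⊴ w = Σ Word λ u → Σ Word λ u′ → w ≡ u ++ v ++ u′

maxV : ∀ {n} → Vec ℕ n → ℕ
maxV = foldr′ _⊔_ 0

record Sig : Set₁ where
  field
    Var : Set
    Op  : Set
    ar  : Op → ℕ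
    sem : (o : Op) → Vec Word (ar o) → Word

module _ (Σs : Sig) where
  open Sig Σs

  -- expressions  e ::= x | op(e1..en) | φ(e1 ↾ e2)
  data Expr : Set where
    var : Var → Expr
    op  : (o : Op) → Vec Expr (ar o) → Expr
    orc : Expr → Expr → Expr

  data Cmd : Set where
    skip   : Cmd
    _≔_    : Var → Expr → Cmd
    _︔_    : Cmd → Cmd → Cmd
    ifte   : Expr → Cmd → Cmd → Cmd
    while  : Expr → Cmd → Cmd

  record Prog : Set where
    constructor _return_
    field
      body : Cmd
      ret  : Var

  data _occursIn_ (x : Var) : Expr → Set where
    here  : x occursIn var x
    inOp  : ∀ {o es} (i : Fin (ar o)) → x occursIn lookup es i → x occursIn op o es
    inOr₁ : ∀ {e₁ e₂} → x occursIn e₁ → x occursIn orc e₁ e₂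
    inOr₂ : ∀ {e₁ e₂} → x occursIn e₂ → x occursIn orc e₁ e₂

  data _subExprOf_ (e : Expr) : Expr → Set where
    refl-sub : e subExprOf e
    inOp     : ∀ {o es} (i : Fin (ar o)) → e subExprOf lookup es i → e subExprOf op o es
    inOr₁    : ∀ {e₁ e₂} → e subExprOf e₁ → e subExprOf orc e₁ e₂
    inOr₂    : ∀ {e₁ e₂} → e subExprOf e₂ → e subExprOf orc e₁ e₂

  data _exprInCmd_ (e : Expr) : Cmd → Set where
    asgL  : ∀ {x e′} → e subExprOf var x → e exprInCmd (x ≔ e′)
    asgR  : ∀ {x e′} → e subExprOf e′ → e exprInCmd (x ≔ e′)
    seq₁  : ∀ {c₁ c₂} → e exprInCmd c₁ → e exprInCmd (c₁ ︔ c₂)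
    seq₂  : ∀ {c₁ c₂} → e exprInCmd c₂ → e exprInCmd (c₁ ︔ c₂)
    ifG   : ∀ {g c₁ c₀} → e subExprOf g → e exprInCmd ifte g c₁ c₀
    if₁   : ∀ {g c₁ c₀} → e exprInCmd c₁ → e exprInCmd ifte g c₁ c₀
    if₀   : ∀ {g c₁ c₀} → e exprInCmd c₀ → e exprInCmd ifte g c₁ c₀
    whG   : ∀ {g c} → e subExprOf g → e exprInCmd while g c
    whB   : ∀ {g c} → e exprInCmd c → e exprInCmd while g c

  data _exprInProg_ (e : Expr) : Prog → Set where
    inBody : ∀ {c x} → e exprInCmd c → e exprInProg (c return x)
    inRet  : ∀ {c x} → e subExprOf var x → e exprInProg (c return x)

  Tier : Set
  Tier = ℕ

  VEnv : Set
  VEnv = Var → Tier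

  -- Operator typing environment: Δ o t_in ts t  means  ts₁ → … → tsₙ → t ∈ Δ(o)(t_in)
  OEnv : Set₁
  OEnv = (o : Op) → Tier → Vec Tier (ar o) → Tier → Set

  module Typing (Γ : VEnv) (Δ : OEnv) where

    data ⊢E_∶_,_,_ : Expr → Tier → Tier → Tier → Set where
      V  : ∀ {x tin tout} → ⊢E var x ∶ Γ x , tin , tout
      OP : ∀ {o es ts t tin tout} → Δ o tin ts t →
           (∀ i → ⊢E lookup es i ∶ lookup ts i , tin , tout) →
           ⊢E op o es ∶ t , tin , tout
      OR : ∀ {e₁ e₂ t tin tout} → ⊢E e₁ ∶ t , tin , tout → ⊢E e₂ ∶ tout , tin , tout →
           t < tin → t ≤ tout → ⊢E orc e₁ e₂ ∶ t , tin , tout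

    data ⊢C_∶_,_,_ : Cmd → Tier → Tier → Tier → Set where
      SUB : ∀ {c t tin tout} → ⊢C c ∶ t , tin , tout → ⊢C c ∶ suc t , tin , tout
      SK  : ∀ {tin tout} → ⊢C skip ∶ 0 , tin , tout
      A   : ∀ {x e t₁ t₂ tin tout} → ⊢E var x ∶ t₁ , tin , tout → ⊢E e ∶ t₂ , tin , tout →
            t₁ ≤ t₂ → ⊢C (x ≔ e) ∶ t₁ , tin , tout
      S   : ∀ {c₁ c₂ t tin tout} → ⊢C c₁ ∶ t , tin , tout → ⊢C c₂ ∶ t , tin , tout →
            ⊢C (c₁ ︔ c₂) ∶ t , tin , tout
      C   : ∀ {e c₁ c₀ t tin tout} → ⊢E e ∶ t , tin , tout → ⊢C c₁ ∶ t , tin , tout →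
            ⊢C c₀ ∶ t , tin , tout → ⊢C ifte e c₁ c₀ ∶ t , tin , tout
      W   : ∀ {e c t tin tout} → ⊢E e ∶ t , tin , tout → ⊢C c ∶ t , t , tout →
            1 ≤ t → t ≤ tout → ⊢C while e c ∶ t , tin , tout
      W₀  : ∀ {e c t tin} → ⊢E e ∶ t , tin , t → ⊢C c ∶ t , t , t →
            1 ≤ t → ⊢C while e c ∶ t , tin , 0

  Neutral : Op → Set
  Neutral o = ar o ≡ 0
            ⊎ (∀ ws → sem o ws ≡ w0 ⊎ sem o ws ≡ w1)
            ⊎ (∀ ws → ∃ λ (i : Fin (ar o)) → sem o ws ⊴ lookup ws i)

  Positive : Op → Set
  Positive o = ∃ λ (c : ℕ) → ∀ ws → length (sem o ws) ≤ maxV (map length ws) + c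

  SafeΔ : (PTime : ∀ {n} → (Vec Word n → Word) → Set) → OEnv → Set
  SafeΔ PTime Δ = ∀ (o : Op) → 0 < ar o → (∃ λ tin → ∃ λ ts → ∃ λ t → Δ o tin ts t) →
      (Neutral o ⊎ Positive o)
    × PTime (sem o)
    × (∀ tin ts t → Δ o tin ts t →
         (∀ i → t ≤ lookup ts i)
       × (∀ i → lookup ts i ≤ tin)
       × (Positive o → ¬ Neutral o → t < tin))

  SafeProg : (PTime : ∀ {n} → (Vec Word n → Word) → Set) → VEnv → OEnv → Prog → Set
  SafeProg PTime Γ Δ (c return x) =
    SafeΔ PTime Δ × (∃ λ t → ∃ λ tin → ∃ λ tout → Typing.⊢C_∶_,_,_ Γ Δ c t tin tout)

module Submission where

open import Defs
open import Data.Nat using (ℕ; _≤_; _<_; suc; s≤s; z≤n)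
open import Data.Nat.Properties using (≤-trans; ≤-refl)
open import Data.Vec using (Vec; lookup)
open import Data.Fin using (Fin)
open import Data.Product using (_,_; proj₁; proj₂)

-- Only safety of Δ matters: an operator's result tier lies below each argument
-- tier, and rule (OR) asks t ≼ t_out for the tier t_out of the query bound, so
-- tiers never decrease on the way from e down to an occurrence of x, where the
-- tier is Γ x.

fin-nonempty : ∀ {n} → Fin n → 0 < n
fin-nonempty {suc n} _ = s≤s z≤n

module _ (S : Sig) (PTime : ∀ {n} → (Vec Word n → Word) → Set)
    (Γ : VEnv S) (Δ : OEnv S) (safe : SafeΔ S PTime Δ) where
  open Typing S Γ Δ using (⊢E_∶_,_,_; V; OP; OR)

  op-result≤arg : ∀ {o tin ts t} → Δ o tin ts t → (i : Fin (Sig.ar S o)) → t ≤ lookup ts i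
  op-result≤arg {o} {tin} {ts} {t} d i =
    proj₁ (proj₂ (proj₂ (safe o (fin-nonempty i) (tin , ts , t , d))) tin ts t d) i

  tier≤occurring-var : ∀ {e t tin tout} → ⊢E e ∶ t , tin , tout →
                       ∀ {x} → _occursIn_ S x e → t ≤ Γ x
  tier≤occurring-var V                here        = ≤-refl
  tier≤occurring-var (OP d ⊢args)     (inOp i oc) = ≤-trans (op-result≤arg d i) (tier≤occurring-var (⊢args i) oc)
  tier≤occurring-var (OR ⊢e₁ _ _ _)   (inOr₁ oc)  = tier≤occurring-var ⊢e₁ oc
  tier≤occurring-var (OR _ ⊢e₂ _ t≤)  (inOr₂ oc)  = ≤-trans t≤ (tier≤occurring-var ⊢e₂ oc)

lemma6p1 : (S : Sig) (PTime : ∀ {n} → (Vec Word n → Word) → Set)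
    (Γ : VEnv S) (Δ : OEnv S) (p : Prog S) →
    SafeProg S PTime Γ Δ p →
    ∀ (e : Expr S) → _exprInProg_ S e p →
    ∀ (t tin tout : ℕ) → Typing.⊢E_∶_,_,_ S Γ Δ e t tin tout →
    ∀ (x : Sig.Var S) → _occursIn_ S x e → t ≤ Γ x
lemma6p1 S PTime Γ Δ (_ return _) (safe , _) _ _ _ _ _ ⊢e _ oc =
  tier≤occurring-var S PTime Γ Δ safe ⊢e oc
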